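{- Fix an even integer $d\ge 2$. For integers $n\ge 1$ let $S_n=\langle a_1(n),a_2(n),a_3(n),a_4(n)\rangle\subseteq\mathbb{N}$ where $a_1(n)=4n^d-2n^{d/2}$, $a_2(n)=4n^d-1$, $a_3(n)=4n^d+2n^{d/2}$, $a_4(n)=4n^d+4n^{d/2}-1$. Then for every field $K$, $\beta_1(K[S_n])\ge 2n^{d/2}$.
   Context: $\langle a_1,\dots,a_4\rangle=\{\sum\lambda_ja_j:\lambda_j\in\mathbb{N}\}$. $\beta_1(K[S_n])$ is the minimal number of generators of the toric ideal $I_{S_n}$, i.e. the kernel of the $K$-algebra map $K[x_1,x_2,x_3,x_4]\to K[y]$ sending $x_j\mapsto y^{a_j(n)}$ (equivalently, the first Betti number of the semigroup algebra $K[S_n]$ in its minimal graded free resolution over $K[x_1,\dots,x_4]$ with $\deg x_j=a_j(n)$). -}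

module Defs where

open import Level using (Level; _⊔_) renaming (suc to lsuc)
open import Data.Nat as ℕ using (ℕ; zero; suc; _∸_; _^_; _≡ᵇ_)
open import Data.Fin as Fin using (Fin)
import Data.Sum
open import Data.Bool using (if_then_else_)
open import Data.Product using (Σ; ∃; _×_)
open import Relation.Nullary using (¬_)
open import Algebra.Bundles using (CommutativeRing)

record Field (c ℓ : Level) : Set (lsuc (c ⊔ ℓ)) where
  field
    commutativeRing : CommutativeRing c ℓ
  open CommutativeRing commutativeRing public
  field
    1≉0     : ¬ (1# ≈ 0#)
    inverse : ∀ x → ¬ (x ≈ 0#) → Σ Carrier λ y → x * y ≈ 1#

module _ {c ℓ} (K : Field c ℓ) where
  open Field K

  sumTo : ℕ → (ℕ → Carrier) → Carrier
  sumTo zero    f = f 0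
  sumTo (suc t) f = sumTo t f + f (suc t)

  sumFin : (m : ℕ) → (Fin m → Carrier) → Carrier
  sumFin zero    f = 0#
  sumFin (suc m) f = f Fin.zero + sumFin m (λ i → f (Fin.suc i))

  -- Polynomials in K[x₁,x₂,x₃,x₄]: coefficient function on exponent
  -- vectors (i,j,k,l) with finite support (coefficients vanish once some
  -- exponent exceeds a bound B).
  record Poly : Set (c ⊔ ℓ) where
    field
      coeff   : ℕ → ℕ → ℕ → ℕ → Carrier
      bound   : ℕ
      support : ∀ i j k l → (bound ℕ.< i) Data.Sum.⊎ (bound ℕ.< j) Data.Sum.⊎
                  (bound ℕ.< k) Data.Sum.⊎ (bound ℕ.< l) → coeff i j k l ≈ 0#
  open Poly public

  mulCoeff : Poly → Poly → ℕ → ℕ → ℕ → ℕ → Carrier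
  mulCoeff p q a b c' e =
    sumTo a λ i → sumTo b λ j → sumTo c' λ k → sumTo e λ l →
      coeff p i j k l * coeff q (a ∸ i) (b ∸ j) (c' ∸ k) (e ∸ l)

  InIdeal : (m : ℕ) → (Fin m → Poly) → Poly → Set (c ⊔ ℓ)
  InIdeal m g p = Σ (Fin m → Poly) λ h → ∀ a b c' e →
    coeff p a b c' e ≈ sumFin m (λ r → mulCoeff (h r) (g r) a b c' e)

  -- p lies in the kernel of x_j ↦ y^(w_j): for every t, the sum of the
  -- coefficients of the monomials x^α with α·w = t vanishes.  (All w_j ≥ 1
  -- in our application, so such α have all entries ≤ t.)
  InToricIdeal : (w₁ w₂ w₃ w₄ : ℕ) → Poly → Set ℓ
  InToricIdeal w₁ w₂ w₃ w₄ p = ∀ t →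
    (sumTo t λ i → sumTo t λ j → sumTo t λ k → sumTo t λ l →
      if (i ℕ.* w₁ ℕ.+ j ℕ.* w₂ ℕ.+ k ℕ.* w₃ ℕ.+ l ℕ.* w₄) ≡ᵇ t
      then coeff p i j k l else 0#) ≈ 0#

  GeneratesToric : (w₁ w₂ w₃ w₄ : ℕ) (m : ℕ) → (Fin m → Poly) → Set (c ⊔ ℓ)
  GeneratesToric w₁ w₂ w₃ w₄ m g =
    (∀ r → InToricIdeal w₁ w₂ w₃ w₄ (g r)) ×
    (∀ p → InToricIdeal w₁ w₂ w₃ w₄ p → InIdeal m g p)

  -- β₁(K[S]) ≥ N : no generating set of I_S has fewer than N elements
  -- (for the positively graded ideal I_S, β₁ = μ(I_S), the minimal number
  -- of generators).
  β₁≥ : (w₁ w₂ w₃ w₄ : ℕ) → ℕ → Set (c ⊔ ℓ)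
  β₁≥ w₁ w₂ w₃ w₄ N = ∀ m → m ℕ.< N → (g : Fin m → Poly) →
    ¬ GeneratesToric w₁ w₂ w₃ w₄ m g

-- the generators, with d = 2k (so d/2 = k)
a₁ a₂ a₃ a₄ : ℕ → ℕ → ℕ
a₁ k n = 4 ℕ.* n ^ (2 ℕ.* k) ∸ 2 ℕ.* n ^ k
a₂ k n = 4 ℕ.* n ^ (2 ℕ.* k) ∸ 1
a₃ k n = 4 ℕ.* n ^ (2 ℕ.* k) ℕ.+ 2 ℕ.* n ^ k
a₄ k n = 4 ℕ.* n ^ (2 ℕ.* k) ℕ.+ 4 ℕ.* n ^ k ∸ 1

module Submission where

-- Write M = 1 + p and q = 2M − 1.  The toric ideal I_S contains the 2M binomials
--   f_i = x₃^(q−i) x₄^i − x₁^(2+q−i) x₂^i   (0 ≤ i ≤ q),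
-- f_i homogeneous of degree σ i = q·(a₃ + i).  The degrees σ i are "pure": no monomial of that
-- degree involves both {x₁,x₂} and {x₃,x₄} (a divisibility argument modulo the odd number q).
-- For a degree s let Φ s (h) be the sum of the coefficients of the x₃x₄-monomials of h in degree s.
-- If s is pure and g ∈ I_S then Φ s (h·g) = h(0)·Φ s (g) for every h.  Hence if g₁,…,g_m
-- generate I_S and f_t = Σ_r h_{t r} g_r, the 2M×2M identity matrix (Φ (σ d) (f_t))_{t,d}
-- factors through K^m, so m ≥ 2M by the dimension bound of linear algebra.

open import Defs
open import Level using (Level; _⊔_)
open import Data.Nat as ℕ using (ℕ; zero; suc; _≤_; _<_; _∸_; z≤n; s≤s; _≤?_)
open import Data.Nat.Properties as ℕ using (≤-refl; ≤-trans; ≤-reflexive; m≤n⇒m≤1+n; m≤m+n; m≤n+m; <⇒≱)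
open import Data.Nat.Tactic.RingSolver using (solve-∀)
open import Data.Fin as Fin using (Fin; toℕ; punchIn)
open import Data.Fin.Properties using (punchInᵢ≢i; toℕ<n; toℕ-injective)
open import Data.Bool using (true; false; if_then_else_)
open import Data.Maybe using (nothing)
open import Data.Empty using (⊥; ⊥-elim)
open import Data.Product using (∃; _×_; _,_; proj₁; proj₂)
open import Data.Product.Properties using (≡-dec)
open import Data.Sum using (_⊎_; inj₁; inj₂; [_,_])
open import Relation.Nullary using (¬_; Dec; does; yes; no)
open import Relation.Nullary.Decidable using (dec-true; dec-false; ¬¬-excluded-middle)
open import Relation.Binary.Definitions using (DecidableEquality)
open import Relation.Binary.PropositionalEquality as ≡ using (_≡_; _≢_)

module FiniteSums {c ℓ} (K : Field c ℓ) where
  open Field K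
  open import Relation.Binary.Reasoning.Setoid setoid
  open import Algebra.Solver.Ring.NaturalCoefficients commutativeSemiring (λ _ _ → nothing)
  open import Algebra.Properties.AbelianGroup +-abelianGroup using (⁻¹-∙-comm)
  open import Algebra.Properties.Ring ring using () renaming (-0#≈0# to -0≈0)

  Σ< : (m : ℕ) → (Fin m → Carrier) → Carrier
  Σ< = sumFin K

  Σ≤ : ℕ → (ℕ → Carrier) → Carrier
  Σ≤ = sumTo K

  neg-+ : ∀ a b → - (a + b) ≈ - a + - b
  neg-+ a b = sym (⁻¹-∙-comm a b)

  interchange : ∀ a b x y → (a + b) + (x + y) ≈ (a + x) + (b + y)
  interchange = solve 4 (λ a b x y → (a :+ b) :+ (x :+ y) := (a :+ x) :+ (b :+ y)) refl

  if-yes : ∀ {a} {A : Set a} (a? : Dec A) {x y : Carrier} → A → (if does a? then x else y) ≈ x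
  if-yes a? a rewrite dec-true a? a = refl

  if-no : ∀ {a} {A : Set a} (a? : Dec A) {x y : Carrier} → ¬ A → (if does a? then x else y) ≈ y
  if-no a? ¬a rewrite dec-false a? ¬a = refl

  if-agree : ∀ {a b} {A : Set a} {B : Set b} → (A → B) → (B → A) → (a? : Dec A) (b? : Dec B) {x y : Carrier} →
             (if does a? then x else y) ≈ (if does b? then x else y)
  if-agree A→B B→A (yes a) b? = sym (if-yes b? (A→B a))
  if-agree A→B B→A (no ¬a) b? = sym (if-no b? (λ b → ¬a (B→A b)))

  if-cong : ∀ b {x y : Carrier} → x ≈ y → (if b then x else 0#) ≈ (if b then y else 0#)
  if-cong true  x≈y = x≈y
  if-cong false _   = refl

  if-zero : ∀ b {x : Carrier} → x ≈ 0# → (if b then x else 0#) ≈ 0#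
  if-zero true  x≈0 = x≈0
  if-zero false _   = refl

  Σ<-cong : ∀ m {f g : Fin m → Carrier} → (∀ r → f r ≈ g r) → Σ< m f ≈ Σ< m g
  Σ<-cong zero    f≈g = refl
  Σ<-cong (suc m) f≈g = +-cong (f≈g _) (Σ<-cong m (λ r → f≈g (Fin.suc r)))

  Σ<-zero : ∀ m (f : Fin m → Carrier) → (∀ r → f r ≈ 0#) → Σ< m f ≈ 0#
  Σ<-zero zero    f f≈0 = refl
  Σ<-zero (suc m) f f≈0 = trans (+-cong (f≈0 _) (Σ<-zero m _ (λ r → f≈0 (Fin.suc r)))) (+-identityˡ 0#)

  Σ<-+ : ∀ m (f g : Fin m → Carrier) → Σ< m (λ r → f r + g r) ≈ Σ< m f + Σ< m g
  Σ<-+ zero    f g = sym (+-identityˡ 0#)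
  Σ<-+ (suc m) f g = trans (+-congˡ (Σ<-+ m _ _)) (interchange _ _ _ _)

  Σ<-neg : ∀ m (f : Fin m → Carrier) → - Σ< m f ≈ Σ< m (λ r → - f r)
  Σ<-neg zero    f = -0≈0
  Σ<-neg (suc m) f = trans (neg-+ _ _) (+-congˡ (Σ<-neg m _))

  Σ<-*ˡ : ∀ m a (f : Fin m → Carrier) → a * Σ< m f ≈ Σ< m (λ r → a * f r)
  Σ<-*ˡ zero    a f = zeroʳ a
  Σ<-*ˡ (suc m) a f = trans (distribˡ a _ _) (+-congˡ (Σ<-*ˡ m a _))

  Σ<-*ʳ : ∀ m a (f : Fin m → Carrier) → Σ< m f * a ≈ Σ< m (λ r → f r * a)
  Σ<-*ʳ m a f = trans (*-comm _ a) (trans (Σ<-*ˡ m a f) (Σ<-cong m (λ r → *-comm a (f r))))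

  Σ<-sub : ∀ m (f g : Fin m → Carrier) → Σ< m f + - Σ< m g ≈ Σ< m (λ r → f r + - g r)
  Σ<-sub m f g = trans (+-congˡ (Σ<-neg m g)) (sym (Σ<-+ m _ _))

  Σ<-split : ∀ m (r : Fin (suc m)) (f : Fin (suc m) → Carrier) →
             Σ< (suc m) f ≈ f r + Σ< m (λ r′ → f (punchIn r r′))
  Σ<-split m       Fin.zero    f = refl
  Σ<-split (suc m) (Fin.suc r) f = begin
    f Fin.zero + Σ< (suc m) (λ r′ → f (Fin.suc r′))
      ≈⟨ +-congˡ (Σ<-split m r (λ r′ → f (Fin.suc r′))) ⟩
    f Fin.zero + (f (Fin.suc r) + Σ< m (λ r′ → f (Fin.suc (punchIn r r′))))
      ≈⟨ solve 3 (λ a b x → a :+ (b :+ x) := b :+ (a :+ x)) refl _ _ _ ⟩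
    f (Fin.suc r) + (f Fin.zero + Σ< m (λ r′ → f (Fin.suc (punchIn r r′)))) ∎

  Σ<-drop : ∀ m (r : Fin (suc m)) (f : Fin (suc m) → Carrier) → f r ≈ 0# →
            Σ< (suc m) f ≈ Σ< m (λ r′ → f (punchIn r r′))
  Σ<-drop m r f fr≈0 = trans (Σ<-split m r f) (trans (+-congʳ fr≈0) (+-identityˡ _))

  Σ<-point : ∀ m (d : Fin m) (f : Fin m → Carrier) → (∀ r → r ≢ d → f r ≈ 0#) → Σ< m f ≈ f d
  Σ<-point (suc m) d f off-d = trans (Σ<-split m d f)
    (trans (+-congˡ (Σ<-zero m _ (λ r → off-d (punchIn d r) (punchInᵢ≢i d r)))) (+-identityʳ _))

  Σ≤-cong : ∀ t {f g : ℕ → Carrier} → (∀ i → i ≤ t → f i ≈ g i) → Σ≤ t f ≈ Σ≤ t g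
  Σ≤-cong zero    f≈g = f≈g 0 z≤n
  Σ≤-cong (suc t) f≈g = +-cong (Σ≤-cong t (λ i i≤t → f≈g i (m≤n⇒m≤1+n i≤t))) (f≈g (suc t) ≤-refl)

  Σ≤-zero : ∀ t (f : ℕ → Carrier) → (∀ i → i ≤ t → f i ≈ 0#) → Σ≤ t f ≈ 0#
  Σ≤-zero zero    f f≈0 = f≈0 0 z≤n
  Σ≤-zero (suc t) f f≈0 =
    trans (+-cong (Σ≤-zero t f (λ i i≤t → f≈0 i (m≤n⇒m≤1+n i≤t))) (f≈0 (suc t) ≤-refl)) (+-identityˡ 0#)

  Σ≤-+ : ∀ t (f g : ℕ → Carrier) → Σ≤ t (λ i → f i + g i) ≈ Σ≤ t f + Σ≤ t g
  Σ≤-+ zero    f g = refl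
  Σ≤-+ (suc t) f g = trans (+-congʳ (Σ≤-+ t f g)) (interchange _ _ _ _)

  Σ≤-neg : ∀ t (f : ℕ → Carrier) → Σ≤ t (λ i → - f i) ≈ - Σ≤ t f
  Σ≤-neg zero    f = refl
  Σ≤-neg (suc t) f = trans (+-congʳ (Σ≤-neg t f)) (sym (neg-+ _ _))

  Σ≤-sub : ∀ t (f g : ℕ → Carrier) → Σ≤ t (λ i → f i + - g i) ≈ Σ≤ t f + - Σ≤ t g
  Σ≤-sub t f g = trans (Σ≤-+ t f (λ i → - g i)) (+-congˡ (Σ≤-neg t g))

  Σ≤-*ˡ : ∀ t a (f : ℕ → Carrier) → a * Σ≤ t f ≈ Σ≤ t (λ i → a * f i)
  Σ≤-*ˡ zero    a f = refl
  Σ≤-*ˡ (suc t) a f = trans (distribˡ a _ _) (+-congʳ (Σ≤-*ˡ t a f))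

  Σ≤-swap : ∀ a b (F : ℕ → ℕ → Carrier) → Σ≤ a (λ i → Σ≤ b (F i)) ≈ Σ≤ b (λ j → Σ≤ a (λ i → F i j))
  Σ≤-swap zero    b F = refl
  Σ≤-swap (suc a) b F = trans (+-congʳ (Σ≤-swap a b F)) (sym (Σ≤-+ b _ _))

  Σ≤-Σ< : ∀ t m (F : ℕ → Fin m → Carrier) → Σ≤ t (λ i → Σ< m (F i)) ≈ Σ< m (λ r → Σ≤ t (λ i → F i r))
  Σ≤-Σ< zero    m F = refl
  Σ≤-Σ< (suc t) m F = trans (+-congʳ (Σ≤-Σ< t m F)) (sym (Σ<-+ m _ _))

  Σ≤-if : ∀ b t (f : ℕ → Carrier) → Σ≤ t (λ i → if b then f i else 0#) ≈ (if b then Σ≤ t f else 0#)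
  Σ≤-if true  t f = refl
  Σ≤-if false t f = Σ≤-zero t _ (λ _ _ → refl)

  Σ≤-truncate : ∀ t b (f : ℕ → Carrier) → b ≤ t → (∀ i → b < i → i ≤ t → f i ≈ 0#) → Σ≤ t f ≈ Σ≤ b f
  Σ≤-truncate zero    zero f z≤n _ = refl
  Σ≤-truncate (suc t) b f b≤1+t tail≈0 with ℕ.m≤n⇒m<n∨m≡n b≤1+t
  ... | inj₂ ≡.refl      = refl
  ... | inj₁ (s≤s b≤t) = trans
    (+-cong (Σ≤-truncate t b f b≤t (λ i b<i i≤t → tail≈0 i b<i (m≤n⇒m≤1+n i≤t))) (tail≈0 (suc t) (s≤s b≤t) ≤-refl))
    (+-identityʳ _)

  Σ≤-point : ∀ t j (f : ℕ → Carrier) → j ≤ t → (∀ i → i ≤ t → i ≢ j → f i ≈ 0#) → Σ≤ t f ≈ f j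
  Σ≤-point t j f j≤t off-j =
    trans (Σ≤-truncate t j f j≤t (λ i j<i i≤t → off-j i i≤t (λ i≡j → ℕ.<-irrefl (≡.sym i≡j) j<i)))
          (last j ≤-refl)
    where
    last : ∀ j′ → j′ ≤ j → Σ≤ j′ f ≈ f j′
    last zero     _     = refl
    last (suc j′) j′<j = trans
      (+-congʳ (Σ≤-zero j′ f (λ i i≤j′ → off-j i (≤-trans (m≤n⇒m≤1+n i≤j′) (≤-trans j′<j j≤t))
                                                (λ i≡j → ℕ.<-irrefl i≡j (≤-trans (s≤s i≤j′) j′<j)))))
      (+-identityˡ _)

  Σ≤-shift : ∀ c d (G : ℕ → Carrier) →
             Σ≤ (c ℕ.+ d) (λ a → if does (c ≤? a) then G (a ∸ c) else 0#) ≈ Σ≤ d G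
  Σ≤-shift c zero G = begin
    Σ≤ (c ℕ.+ 0) H ≡⟨ ≡.cong (λ t → Σ≤ t H) (ℕ.+-identityʳ c) ⟩
    Σ≤ c H         ≈⟨ Σ≤-point c c H ≤-refl (λ a a≤c a≢c → if-no (c ≤? a) (λ c≤a → a≢c (ℕ.≤-antisym a≤c c≤a))) ⟩
    H c            ≈⟨ if-yes (c ≤? c) ≤-refl ⟩
    G (c ∸ c)      ≡⟨ ≡.cong G (ℕ.n∸n≡0 c) ⟩
    G 0            ∎
    where H = λ a → if does (c ≤? a) then G (a ∸ c) else 0#
  Σ≤-shift c (suc d) G = begin
    Σ≤ (c ℕ.+ suc d) H                ≡⟨ ≡.cong (λ t → Σ≤ t H) (ℕ.+-suc c d) ⟩
    Σ≤ (c ℕ.+ d) H + H (suc (c ℕ.+ d)) ≈⟨ +-cong (Σ≤-shift c d G) (if-yes (c ≤? _) (ℕ.m≤n⇒m≤1+n (ℕ.m≤m+n c d))) ⟩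
    Σ≤ d G + G (suc (c ℕ.+ d) ∸ c)    ≡⟨ ≡.cong (λ a → Σ≤ d G + G a) (≡.trans (≡.cong (_∸ c) (≡.sym (ℕ.+-suc c d)))
                                                                             (ℕ.m+n∸m≡n c (suc d))) ⟩
    Σ≤ d G + G (suc d)                ∎
    where H = λ a → if does (c ≤? a) then G (a ∸ c) else 0#

  Σ≤-reindex : ∀ c s (F : ℕ → ℕ → Carrier) → c ≤ s →
    Σ≤ s (λ a → if does (c ≤? a) then F a (a ∸ c) else 0#) ≈ Σ≤ (s ∸ c) (λ a′ → F (a′ ℕ.+ c) a′)
  Σ≤-reindex c s F c≤s = begin
    Σ≤ s (λ a → if does (c ≤? a) then F a (a ∸ c) else 0#)
      ≡⟨ ≡.cong (λ t → Σ≤ t _) (≡.sym (ℕ.m+[n∸m]≡n c≤s)) ⟩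
    Σ≤ (c ℕ.+ (s ∸ c)) (λ a → if does (c ≤? a) then F a (a ∸ c) else 0#)
      ≈⟨ Σ≤-cong (c ℕ.+ (s ∸ c)) (λ a _ → first-argument a (c ≤? a)) ⟩
    Σ≤ (c ℕ.+ (s ∸ c)) (λ a → if does (c ≤? a) then F ((a ∸ c) ℕ.+ c) (a ∸ c) else 0#)
      ≈⟨ Σ≤-shift c (s ∸ c) (λ a′ → F (a′ ℕ.+ c) a′) ⟩
    Σ≤ (s ∸ c) (λ a′ → F (a′ ℕ.+ c) a′) ∎
    where
    first-argument : ∀ a (c≤?a : Dec (c ≤ a)) →
      (if does c≤?a then F a (a ∸ c) else 0#) ≈ (if does c≤?a then F ((a ∸ c) ℕ.+ c) (a ∸ c) else 0#)
    first-argument a (yes c≤a) = reflexive (≡.cong (λ x → F x (a ∸ c)) (≡.sym (ℕ.m∸n+n≡m c≤a)))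
    first-argument a (no _)    = refl

  Σ²-truncate : ∀ A B a b (F : ℕ → ℕ → Carrier) → a ≤ A → b ≤ B →
    (∀ k l → a < k ⊎ b < l → F k l ≈ 0#) → Σ≤ A (λ k → Σ≤ B (F k)) ≈ Σ≤ a (λ k → Σ≤ b (F k))
  Σ²-truncate A B a b F a≤A b≤B outside≈0 = trans
    (Σ≤-truncate A a _ a≤A (λ k a<k _ → Σ≤-zero B _ (λ l _ → outside≈0 k l (inj₁ a<k))))
    (Σ≤-cong a (λ k _ → Σ≤-truncate B b _ b≤B (λ l b<l _ → outside≈0 k l (inj₂ b<l))))

  Σ²-point : ∀ s a b (Q : ℕ → ℕ → Carrier) → a ≤ s → b ≤ s →
    (∀ c e → c ≤ s → e ≤ s → c ≢ a ⊎ e ≢ b → Q c e ≈ 0#) → Σ≤ s (λ c → Σ≤ s (Q c)) ≈ Q a b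
  Σ²-point s a b Q a≤s b≤s off≈0 = trans
    (Σ≤-point s a _ a≤s (λ c c≤s c≢a → Σ≤-zero s _ (λ e e≤s → off≈0 c e c≤s e≤s (inj₁ c≢a))))
    (Σ≤-point s b _ b≤s (λ e e≤s e≢b → off≈0 a e a≤s e≤s (inj₂ e≢b)))

  Σ²-swap : ∀ s (F : ℕ → ℕ → ℕ → ℕ → Carrier) →
    (Σ≤ s λ k → Σ≤ s λ l → Σ≤ s λ c → Σ≤ s λ e → F k l c e)
      ≈ (Σ≤ s λ c → Σ≤ s λ e → Σ≤ s λ k → Σ≤ s λ l → F k l c e)
  Σ²-swap s F = begin
    (Σ≤ s λ k → Σ≤ s λ l → Σ≤ s λ c → Σ≤ s λ e → F k l c e)
      ≈⟨ Σ≤-cong s (λ k _ → Σ≤-swap s s (λ l c → Σ≤ s (F k l c))) ⟩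
    (Σ≤ s λ k → Σ≤ s λ c → Σ≤ s λ l → Σ≤ s λ e → F k l c e)
      ≈⟨ Σ≤-swap s s (λ k c → Σ≤ s λ l → Σ≤ s (F k l c)) ⟩
    (Σ≤ s λ c → Σ≤ s λ k → Σ≤ s λ l → Σ≤ s λ e → F k l c e)
      ≈⟨ Σ≤-cong s (λ c _ → Σ≤-cong s (λ k _ → Σ≤-swap s s (λ l e → F k l c e))) ⟩
    (Σ≤ s λ c → Σ≤ s λ k → Σ≤ s λ e → Σ≤ s λ l → F k l c e)
      ≈⟨ Σ≤-cong s (λ c _ → Σ≤-swap s s (λ k e → Σ≤ s λ l → F k l c e)) ⟩
    (Σ≤ s λ c → Σ≤ s λ e → Σ≤ s λ k → Σ≤ s λ l → F k l c e) ∎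

-- On a finite index set, a failing universal statement has a counterexample — up to double
-- negation, which suffices since we only ever derive ⊥ from it.
¬∀⇒¬¬∃¬ : ∀ {p} m (P : Fin m → Set p) → ¬ (∀ r → P r) → ¬ ¬ (∃ λ r → ¬ P r)
¬∀⇒¬¬∃¬ zero    P ¬∀P _      = ¬∀P (λ ())
¬∀⇒¬¬∃¬ (suc m) P ¬∀P no-cex = ¬¬-excluded-middle λ
  { (no ¬P₀)  → no-cex (Fin.zero , ¬P₀)
  ; (yes P₀) → ¬∀⇒¬¬∃¬ m (λ r → P (Fin.suc r))
                 (λ ∀P′ → ¬∀P (λ { Fin.zero → P₀ ; (Fin.suc r) → ∀P′ r }))
                 (λ { (r , ¬Pr) → no-cex (Fin.suc r , ¬Pr) }) }

module LinearAlgebra {c ℓ} (K : Field c ℓ) where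
  open Field K
  open FiniteSums K
  open import Relation.Binary.Reasoning.Setoid setoid
  open import Algebra.Solver.Ring.NaturalCoefficients commutativeSemiring (λ _ _ → nothing)
  open import Algebra.Properties.Ring ring using (-‿distribˡ-*; -‿distribʳ-*)

  Independent : ∀ {D : Set} N → (Fin N → D → Carrier) → Set (c ⊔ ℓ)
  Independent N u = ∀ (α : Fin N → Carrier) → (∀ d → Σ< N (λ t → α t * u t d) ≈ 0#) → ∀ t → α t ≈ 0#

  IsCombination : ∀ {D : Set} {N m} → (Fin N → D → Carrier) → (Fin N → Fin m → Carrier) → (Fin m → D → Carrier) → Set ℓ
  IsCombination {m = m} u cf v = ∀ t d → u t d ≈ Σ< m (λ r → cf t r * v r d)

  independent-nonzero : ∀ {D : Set} {N} (u : Fin N → D → Carrier) → Independent N u → ∀ t → ¬ (∀ d → u t d ≈ 0#)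
  independent-nonzero {N = N} u ind t uₜ≈0 = 1≉0 (trans (sym (if-yes (t Fin.≟ t) ≡.refl)) (ind δₜ Σ≈0 t))
    where
    δₜ : Fin N → Carrier
    δₜ t′ = if does (t′ Fin.≟ t) then 1# else 0#
    Σ≈0 : ∀ d → Σ< N (λ t′ → δₜ t′ * u t′ d) ≈ 0#
    Σ≈0 d = trans (Σ<-point N t _ (λ t′ t′≢t → trans (*-congʳ (if-no (t′ Fin.≟ t) t′≢t)) (zeroˡ _)))
                  (trans (*-congˡ (uₜ≈0 d)) (zeroʳ _))

  sub-scaled-*ʳ : ∀ f a g w → f * w + - (a * (g * w)) ≈ (f + - (a * g)) * w
  sub-scaled-*ʳ f a g w = begin
    f * w + - (a * (g * w)) ≈⟨ +-congˡ (-‿cong (sym (*-assoc a g w))) ⟩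
    f * w + - (a * g * w)   ≈⟨ +-congˡ (-‿distribˡ-* _ _) ⟩
    f * w + - (a * g) * w   ≈⟨ sym (distribʳ w f _) ⟩
    (f + - (a * g)) * w     ∎

  sub-scaled-*ˡ : ∀ l x m y → l * x + - (l * m * y) ≈ l * (x + - (m * y))
  sub-scaled-*ˡ l x m y = begin
    l * x + - (l * m * y)   ≈⟨ +-congˡ (-‿cong (*-assoc l m y)) ⟩
    l * x + - (l * (m * y)) ≈⟨ +-congˡ (-‿distribʳ-* _ _) ⟩
    l * x + l * - (m * y)   ≈⟨ sym (distribˡ l x _) ⟩
    l * (x + - (m * y))     ∎

  -- One step of Gaussian elimination.  Subtracting suitable multiples of u₀ from the other
  -- u's clears column r, so the N remaining vectors u′ are combinations of the m vectors v′ (v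
  -- without v_r); and if u was independent, so is u′.
  module Elimination {D : Set} {N m : ℕ} (u : Fin (suc N) → D → Carrier)
    (cf : Fin (suc N) → Fin (suc m) → Carrier) (v : Fin (suc m) → D → Carrier)
    (r : Fin (suc m)) (pivot≉0 : ¬ cf Fin.zero r ≈ 0#) where

    pivot⁻¹ : Carrier
    pivot⁻¹ = proj₁ (inverse _ pivot≉0)

    μ : Fin N → Carrier
    μ t = cf (Fin.suc t) r * pivot⁻¹

    μ-clears : ∀ t → μ t * cf Fin.zero r ≈ cf (Fin.suc t) r
    μ-clears t = begin
      cf (Fin.suc t) r * pivot⁻¹ * cf Fin.zero r   ≈⟨ solve 3 (λ a b c → a :* b :* c := a :* (c :* b)) refl _ _ _ ⟩
      cf (Fin.suc t) r * (cf Fin.zero r * pivot⁻¹) ≈⟨ *-congˡ (proj₂ (inverse _ pivot≉0)) ⟩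
      cf (Fin.suc t) r * 1#                         ≈⟨ *-identityʳ _ ⟩
      cf (Fin.suc t) r                              ∎

    u′ : Fin N → D → Carrier
    u′ t d = u (Fin.suc t) d + - (μ t * u Fin.zero d)

    cf′ : Fin N → Fin m → Carrier
    cf′ t r′ = cf (Fin.suc t) (punchIn r r′) + - (μ t * cf Fin.zero (punchIn r r′))

    v′ : Fin m → D → Carrier
    v′ r′ = v (punchIn r r′)

    combination′ : IsCombination u cf v → IsCombination u′ cf′ v′
    combination′ u≈cf·v t d = begin
      u (Fin.suc t) d + - (μ t * u Fin.zero d)
        ≈⟨ +-cong (u≈cf·v (Fin.suc t) d) (-‿cong (*-congˡ (u≈cf·v Fin.zero d))) ⟩
      Σ< (suc m) (λ r″ → cf (Fin.suc t) r″ * v r″ d) + - (μ t * Σ< (suc m) (λ r″ → cf Fin.zero r″ * v r″ d))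
        ≈⟨ +-congˡ (-‿cong (Σ<-*ˡ (suc m) (μ t) (λ r″ → cf Fin.zero r″ * v r″ d))) ⟩
      Σ< (suc m) (λ r″ → cf (Fin.suc t) r″ * v r″ d) + - Σ< (suc m) (λ r″ → μ t * (cf Fin.zero r″ * v r″ d))
        ≈⟨ Σ<-sub (suc m) (λ r″ → cf (Fin.suc t) r″ * v r″ d) (λ r″ → μ t * (cf Fin.zero r″ * v r″ d)) ⟩
      Σ< (suc m) (λ r″ → cf (Fin.suc t) r″ * v r″ d + - (μ t * (cf Fin.zero r″ * v r″ d)))
        ≈⟨ Σ<-cong (suc m) (λ r″ → sub-scaled-*ʳ (cf (Fin.suc t) r″) (μ t) (cf Fin.zero r″) (v r″ d)) ⟩
      Σ< (suc m) (λ r″ → (cf (Fin.suc t) r″ + - (μ t * cf Fin.zero r″)) * v r″ d)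
        ≈⟨ Σ<-drop m r (λ r″ → (cf (Fin.suc t) r″ + - (μ t * cf Fin.zero r″)) * v r″ d) column-r≈0 ⟩
      Σ< m (λ r′ → cf′ t r′ * v′ r′ d) ∎
      where
      column-r≈0 : (cf (Fin.suc t) r + - (μ t * cf Fin.zero r)) * v r d ≈ 0#
      column-r≈0 = trans (*-congʳ (trans (+-congˡ (-‿cong (μ-clears t))) (-‿inverseʳ _))) (zeroˡ _)

    independent′ : Independent (suc N) u → Independent N u′
    independent′ ind α Σαu′≈0 t = ind α⁺ Σα⁺u≈0 (Fin.suc t)
      where
      -- extend α by the coefficient of u₀ hidden in the u′'s
      α⁺ : Fin (suc N) → Carrier
      α⁺ Fin.zero    = - Σ< N (λ t → α t * μ t)
      α⁺ (Fin.suc t) = α t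
      Σα⁺u≈0 : ∀ d → Σ< (suc N) (λ t → α⁺ t * u t d) ≈ 0#
      Σα⁺u≈0 d = begin
        - Σ< N (λ t → α t * μ t) * u₀ + Σ< N (λ t → α t * u (Fin.suc t) d)
          ≈⟨ trans (+-congʳ (sym (-‿distribˡ-* _ _))) (+-comm _ _) ⟩
        Σ< N (λ t → α t * u (Fin.suc t) d) + - (Σ< N (λ t → α t * μ t) * u₀)
          ≈⟨ +-congˡ (-‿cong (Σ<-*ʳ N u₀ _)) ⟩
        Σ< N (λ t → α t * u (Fin.suc t) d) + - Σ< N (λ t → α t * μ t * u₀)
          ≈⟨ Σ<-sub N _ _ ⟩
        Σ< N (λ t → α t * u (Fin.suc t) d + - (α t * μ t * u₀))
          ≈⟨ Σ<-cong N (λ t → sub-scaled-*ˡ (α t) (u (Fin.suc t) d) (μ t) u₀) ⟩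
        Σ< N (λ t → α t * u′ t d)
          ≈⟨ Σαu′≈0 d ⟩
        0# ∎
        where u₀ = u Fin.zero d

  -- Dimension bound (Steinitz): N independent vectors in the span of m < N vectors cannot exist.
  -- Induction on m: eliminate a pivot from the (necessarily nonzero) first row of cf.
  dimension-bound : ∀ {D : Set} m N → m < N → (u : Fin N → D → Carrier) (cf : Fin N → Fin m → Carrier)
    (v : Fin m → D → Carrier) → IsCombination u cf v → Independent N u → ⊥
  dimension-bound zero    (suc N) _          u cf v u≈cf·v ind = independent-nonzero u ind Fin.zero (u≈cf·v Fin.zero)
  dimension-bound (suc m) (suc N) (s≤s m<N) u cf v u≈cf·v ind =
    ¬∀⇒¬¬∃¬ (suc m) (λ r → cf Fin.zero r ≈ 0#) row₀≉0 λ { (r , pivot≉0) →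
      let open Elimination u cf v r pivot≉0 in
      dimension-bound m N m<N u′ cf′ v′ (combination′ u≈cf·v) (independent′ ind) }
    where
    row₀≉0 : ¬ (∀ r → cf Fin.zero r ≈ 0#)
    row₀≉0 row₀≈0 = independent-nonzero u ind Fin.zero λ d →
      trans (u≈cf·v Fin.zero d) (Σ<-zero (suc m) (λ r → cf Fin.zero r * v r d) (λ r → trans (*-congʳ (row₀≈0 r)) (zeroˡ _)))

Exponent : Set
Exponent = ℕ × ℕ × ℕ × ℕ

_≟ₑ_ : DecidableEquality Exponent
_≟ₑ_ = ≡-dec ℕ._≟_ (≡-dec ℕ._≟_ (≡-dec ℕ._≟_ ℕ._≟_))

Below : ℕ → Exponent → Set
Below T (a , b , c , d) = a ≤ T × b ≤ T × c ≤ T × d ≤ T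

below-mono : ∀ {T T′} α → T ≤ T′ → Below T α → Below T′ α
below-mono α T≤T′ (a≤ , b≤ , c≤ , d≤) =
  ≤-trans a≤ T≤T′ , ≤-trans b≤ T≤T′ , ≤-trans c≤ T≤T′ , ≤-trans d≤ T≤T′

beyond : ∀ {T} α i j k l → Below T α → T < i ⊎ T < j ⊎ T < k ⊎ T < l → (i , j , k , l) ≢ α
beyond α i j k l (a≤ , _ , _ , _) (inj₁ T<i)               ≡.refl = <⇒≱ T<i a≤
beyond α i j k l (_ , b≤ , _ , _) (inj₂ (inj₁ T<j))        ≡.refl = <⇒≱ T<j b≤
beyond α i j k l (_ , _ , c≤ , _) (inj₂ (inj₂ (inj₁ T<k))) ≡.refl = <⇒≱ T<k c≤
beyond α i j k l (_ , _ , _ , d≤) (inj₂ (inj₂ (inj₂ T<l))) ≡.refl = <⇒≱ T<l d≤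

1≤+ : ∀ a b → a ≢ 0 ⊎ b ≢ 0 → 1 ≤ a ℕ.+ b
1≤+ (suc a) b       _              = s≤s z≤n
1≤+ zero    (suc b) _              = s≤s z≤n
1≤+ zero    zero    (inj₁ 0≢0)     = ⊥-elim (0≢0 ≡.refl)
1≤+ zero    zero    (inj₂ 0≢0)     = ⊥-elim (0≢0 ≡.refl)

module Grading (w₁ w₂ w₃ w₄ : ℕ) (w₁≥1 : 1 ≤ w₁) (w₂≥1 : 1 ≤ w₂) (w₃≥1 : 1 ≤ w₃) (w₄≥1 : 1 ≤ w₄) where

  deg : ℕ → ℕ → ℕ → ℕ → ℕ
  deg a b c d = a ℕ.* w₁ ℕ.+ b ℕ.* w₂ ℕ.+ c ℕ.* w₃ ℕ.+ d ℕ.* w₄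

  degₑ : Exponent → ℕ
  degₑ (a , b , c , d) = deg a b c d

  below-deg : ∀ α → Below (degₑ α) α
  below-deg (a , b , c , d) =
    ≤-trans (ℕ.m≤m*n a w₁ {{ℕ.>-nonZero w₁≥1}}) (≤-trans (m≤m+n _ _) (≤-trans (m≤m+n _ _) (m≤m+n _ _))) ,
    ≤-trans (ℕ.m≤m*n b w₂ {{ℕ.>-nonZero w₂≥1}}) (≤-trans (m≤n+m _ (a ℕ.* w₁)) (≤-trans (m≤m+n _ _) (m≤m+n _ _))) ,
    ≤-trans (ℕ.m≤m*n c w₃ {{ℕ.>-nonZero w₃≥1}}) (≤-trans (m≤n+m _ (a ℕ.* w₁ ℕ.+ b ℕ.* w₂)) (m≤m+n _ _)) ,
    ≤-trans (ℕ.m≤m*n d w₄ {{ℕ.>-nonZero w₄≥1}}) (m≤n+m _ (a ℕ.* w₁ ℕ.+ b ℕ.* w₂ ℕ.+ c ℕ.* w₃))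

  deg-shift : ∀ i j k l c e → deg i j (k ℕ.+ c) (l ℕ.+ e) ≡ deg i j k l ℕ.+ deg 0 0 c e
  deg-shift i j k l c e = identity i j k l c e w₁ w₂ w₃ w₄
    where
    identity : ∀ i j k l c e w₁ w₂ w₃ w₄ →
      i ℕ.* w₁ ℕ.+ j ℕ.* w₂ ℕ.+ (k ℕ.+ c) ℕ.* w₃ ℕ.+ (l ℕ.+ e) ℕ.* w₄
      ≡ (i ℕ.* w₁ ℕ.+ j ℕ.* w₂ ℕ.+ k ℕ.* w₃ ℕ.+ l ℕ.* w₄)
          ℕ.+ (0 ℕ.* w₁ ℕ.+ 0 ℕ.* w₂ ℕ.+ c ℕ.* w₃ ℕ.+ e ℕ.* w₄)
    identity = solve-∀

  module Binomials {c ℓ} (K : Field c ℓ) where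
    open Field K
    open FiniteSums K
    open import Relation.Binary.Reasoning.Setoid setoid
    open import Algebra.Properties.Ring ring using () renaming (-0#≈0# to -0≈0)

    Coefficients : Set c
    Coefficients = ℕ → ℕ → ℕ → ℕ → Carrier

    monomial : Exponent → Coefficients
    monomial α i j k l = if does ((i , j , k , l) ≟ₑ α) then 1# else 0#

    monomial-off : ∀ α i j k l → (i , j , k , l) ≢ α → monomial α i j k l ≈ 0#
    monomial-off α i j k l ≢α = if-no ((i , j , k , l) ≟ₑ α) ≢α

    monomial-at : ∀ a b c d → monomial (a , b , c , d) a b c d ≈ 1#
    monomial-at a b c d = if-yes ((a , b , c , d) ≟ₑ (a , b , c , d)) ≡.refl

    binomial : Exponent → Exponent → Poly K
    binomial α β = record
      { coeff   = λ i j k l → monomial α i j k l + - monomial β i j k l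
      ; bound   = bd
      ; support = λ i j k l big → trans
          (+-cong (monomial-off α i j k l (beyond α i j k l α-below big))
                  (-‿cong (monomial-off β i j k l (beyond β i j k l β-below big))))
          (trans (+-congˡ -0≈0) (+-identityʳ 0#))
      }
      where
      bd = degₑ α ℕ.+ degₑ β
      α-below : Below bd α
      α-below = below-mono α (m≤m+n (degₑ α) (degₑ β)) (below-deg α)
      β-below : Below bd β
      β-below = below-mono β (m≤n+m (degₑ β) (degₑ α)) (below-deg β)

    degreeSum : ℕ → Coefficients → Carrier
    degreeSum T F = Σ≤ T λ i → Σ≤ T λ j → Σ≤ T λ k → Σ≤ T λ l →
      if does (deg i j k l ℕ.≟ T) then F i j k l else 0#

    degreeSum-sub : ∀ T F G → degreeSum T (λ i j k l → F i j k l + - G i j k l) ≈ degreeSum T F + - degreeSum T G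
    degreeSum-sub T F G =
      trans (Σ≤-cong T λ i _ → trans (Σ≤-cong T λ j _ → trans (Σ≤-cong T λ k _ →
               trans (Σ≤-cong T λ l _ → if-sub (does (deg i j k l ℕ.≟ T))) (Σ≤-sub T _ _))
             (Σ≤-sub T _ _)) (Σ≤-sub T _ _)) (Σ≤-sub T _ _)
      where
      if-sub : ∀ b {x y} → (if b then x + - y else 0#) ≈ (if b then x else 0#) + - (if b then y else 0#)
      if-sub true  = refl
      if-sub false = sym (trans (+-congˡ -0≈0) (+-identityʳ 0#))

    Σ⁴-point : ∀ T a b c d (F : Coefficients) → Below T (a , b , c , d) →
      (∀ i j k l → (i , j , k , l) ≢ (a , b , c , d) → F i j k l ≈ 0#) →
      (Σ≤ T λ i → Σ≤ T λ j → Σ≤ T λ k → Σ≤ T λ l → F i j k l) ≈ F a b c d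
    Σ⁴-point T a b c d F (a≤ , b≤ , c≤ , d≤) off-α = trans
      (Σ²-point T a b _ a≤ b≤ λ i j _ _ i≢a⊎j≢b → Σ≤-zero T _ λ k _ → Σ≤-zero T _ λ l _ →
         off-α i j k l (λ { ≡.refl → [ (λ i≢a → i≢a ≡.refl) , (λ j≢b → j≢b ≡.refl) ] i≢a⊎j≢b }))
      (Σ²-point T c d _ c≤ d≤ λ k l _ _ k≢c⊎l≢d →
         off-α a b k l (λ { ≡.refl → [ (λ k≢c → k≢c ≡.refl) , (λ l≢d → l≢d ≡.refl) ] k≢c⊎l≢d }))

    degreeSum-monomial : ∀ T α → degreeSum T (monomial α) ≈ (if does (degₑ α ℕ.≟ T) then 1# else 0#)
    degreeSum-monomial T α@(a , b , c , d) = by-cases (degₑ α ℕ.≟ T)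
      where
      by-cases : Dec (degₑ α ≡ T) → degreeSum T (monomial α) ≈ (if does (degₑ α ℕ.≟ T) then 1# else 0#)
      by-cases (yes deg≡T) = begin
        degreeSum T (monomial α)
          ≈⟨ Σ⁴-point T a b c d _ (≡.subst (λ t → Below t α) deg≡T (below-deg α))
               (λ i j k l ≢α → if-zero (does (deg i j k l ℕ.≟ T)) (monomial-off α i j k l ≢α)) ⟩
        (if does (degₑ α ℕ.≟ T) then monomial α a b c d else 0#)
          ≈⟨ trans (if-yes (degₑ α ℕ.≟ T) deg≡T) (monomial-at a b c d) ⟩
        1#
          ≈⟨ sym (if-yes (degₑ α ℕ.≟ T) deg≡T) ⟩
        (if does (degₑ α ℕ.≟ T) then 1# else 0#) ∎
      by-cases (no deg≢T) = trans
        (Σ≤-zero T _ λ i _ → Σ≤-zero T _ λ j _ → Σ≤-zero T _ λ k _ → Σ≤-zero T _ λ l _ →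
           off-degree i j k l ((i , j , k , l) ≟ₑ α))
        (sym (if-no (degₑ α ℕ.≟ T) deg≢T))
        where
        off-degree : ∀ i j k l → Dec ((i , j , k , l) ≡ α) →
          (if does (deg i j k l ℕ.≟ T) then monomial α i j k l else 0#) ≈ 0#
        off-degree i j k l (yes ≡.refl) = if-no (deg i j k l ℕ.≟ T) deg≢T
        off-degree i j k l (no ≢α)      = if-zero (does (deg i j k l ℕ.≟ T)) (monomial-off α i j k l ≢α)

    binomial-toric : ∀ α β → degₑ α ≡ degₑ β → InToricIdeal K w₁ w₂ w₃ w₄ (binomial α β)
    binomial-toric α β deg-α≡deg-β T = begin
      degreeSum T (coeff (binomial α β))
        ≈⟨ degreeSum-sub T (monomial α) (monomial β) ⟩
      degreeSum T (monomial α) + - degreeSum T (monomial β)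
        ≈⟨ +-cong (degreeSum-monomial T α) (-‿cong (degreeSum-monomial T β)) ⟩
      (if does (degₑ α ℕ.≟ T) then 1# else 0#) + - (if does (degₑ β ℕ.≟ T) then 1# else 0#)
        ≡⟨ ≡.cong (λ e → (if does (degₑ α ℕ.≟ T) then 1# else 0#) + - (if does (e ℕ.≟ T) then 1# else 0#))
                  (≡.sym deg-α≡deg-β) ⟩
      (if does (degₑ α ℕ.≟ T) then 1# else 0#) + - (if does (degₑ α ℕ.≟ T) then 1# else 0#)
        ≈⟨ -‿inverseʳ _ ⟩
      0# ∎

  module PureParts {c ℓ} (K : Field c ℓ) where
    open Field K
    open FiniteSums K
    open Binomials K using (Coefficients)
    open import Relation.Binary.Reasoning.Setoid setoid

    Φ : ℕ → (ℕ → ℕ → Carrier) → Carrier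
    Φ t F = Σ≤ t λ k → Σ≤ t λ l → if does (deg 0 0 k l ℕ.≟ t) then F k l else 0#

    Φ-cong : ∀ t {F G : ℕ → ℕ → Carrier} → (∀ k l → F k l ≈ G k l) → Φ t F ≈ Φ t G
    Φ-cong t F≈G = Σ≤-cong t (λ k _ → Σ≤-cong t (λ l _ → if-cong (does (deg 0 0 k l ℕ.≟ t)) (F≈G k l)))

    Φ-Σ< : ∀ t m (F : Fin m → ℕ → ℕ → Carrier) → Φ t (λ k l → Σ< m (λ r → F r k l)) ≈ Σ< m (λ r → Φ t (F r))
    Φ-Σ< t m F = begin
      (Σ≤ t λ k → Σ≤ t λ l → if does (deg 0 0 k l ℕ.≟ t) then Σ< m (λ r → F r k l) else 0#)
        ≈⟨ Σ≤-cong t (λ k _ → Σ≤-cong t (λ l _ → if-Σ< (does (deg 0 0 k l ℕ.≟ t)))) ⟩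
      (Σ≤ t λ k → Σ≤ t λ l → Σ< m λ r → if does (deg 0 0 k l ℕ.≟ t) then F r k l else 0#)
        ≈⟨ Σ≤-cong t (λ k _ → Σ≤-Σ< t m _) ⟩
      (Σ≤ t λ k → Σ< m λ r → Σ≤ t λ l → if does (deg 0 0 k l ℕ.≟ t) then F r k l else 0#)
        ≈⟨ Σ≤-Σ< t m _ ⟩
      Σ< m (λ r → Φ t (F r)) ∎
      where
      if-Σ< : ∀ b {k l} → (if b then Σ< m (λ r → F r k l) else 0#) ≈ Σ< m (λ r → if b then F r k l else 0#)
      if-Σ< true  = refl
      if-Σ< false = sym (Σ<-zero m _ (λ _ → refl))

    Φ-range : ∀ t A B (F : ℕ → ℕ → Carrier) → t ≤ A → t ≤ B →
      (Σ≤ A λ k → Σ≤ B λ l → if does (deg 0 0 k l ℕ.≟ t) then F k l else 0#) ≈ Φ t F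
    Φ-range t A B F t≤A t≤B = Σ²-truncate A B t t _ t≤A t≤B λ k l beyond-t →
      if-no (deg 0 0 k l ℕ.≟ t) λ deg≡t → [ (λ t<k → <⇒≱ t<k (≤-trans (k≤deg k l) (≤-reflexive deg≡t)))
                                          , (λ t<l → <⇒≱ t<l (≤-trans (l≤deg k l) (≤-reflexive deg≡t))) ] beyond-t
      where
      k≤deg : ∀ k l → k ≤ deg 0 0 k l
      k≤deg k l = proj₁ (proj₂ (proj₂ (below-deg (0 , 0 , k , l))))
      l≤deg : ∀ k l → l ≤ deg 0 0 k l
      l≤deg k l = proj₂ (proj₂ (proj₂ (below-deg (0 , 0 , k , l))))

    -- If in degree t only pure x₃x₄-monomials exist, the pure part of a toric polynomial in
    -- degree t is its whole degree-t coefficient sum, which vanishes.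
    Φ-toric : ∀ t (g : Poly K) → InToricIdeal K w₁ w₂ w₃ w₄ g →
      (∀ i j k l → deg i j k l ≡ t → 1 ≤ i ℕ.+ j → ⊥) → Φ t (coeff g 0 0) ≈ 0#
    Φ-toric t g g-toric only-pure = trans
      (sym (Σ²-point t 0 0 _ z≤n z≤n λ i j _ _ i≢0⊎j≢0 → Σ≤-zero t _ λ k _ → Σ≤-zero t _ λ l _ →
              if-no (deg i j k l ℕ.≟ t) (λ deg≡t → only-pure i j k l deg≡t (1≤+ i j i≢0⊎j≢0))))
      (g-toric t)

    -- A monomial x₃^c x₄^e ≠ 1 of h pairs with the pure part of g in
    -- the lower degree s − deg(x₃^c x₄^e), where by purity of s there are only pure monomials,
    -- so that contribution vanishes by Φ-toric.
    module Multiplicative (s : ℕ) (no-mixed : ∀ a b c d → deg a b c d ≡ s → 1 ≤ a ℕ.+ b → 1 ≤ c ℕ.+ d → ⊥)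
      (g : Poly K) (g-toric : InToricIdeal K w₁ w₂ w₃ w₄ g) where

      G : ℕ → ℕ → Carrier
      G = coeff g 0 0

      -- the coefficient of x₃^k x₄^l in x₃^c x₄^e · g, counted when deg 0 0 k l = s
      shifted : ℕ → ℕ → ℕ → ℕ → Carrier
      shifted c e k l = if does (c ℕ.≤? k) then (if does (e ℕ.≤? l) then
                          (if does (deg 0 0 k l ℕ.≟ s) then G (k ∸ c) (l ∸ e) else 0#) else 0#) else 0#

      lifted : ℕ → ℕ → Carrier
      lifted c e = Σ≤ (s ∸ c) λ k′ → Σ≤ (s ∸ e) λ l′ →
                     if does (deg 0 0 (k′ ℕ.+ c) (l′ ℕ.+ e) ℕ.≟ s) then G k′ l′ else 0#

      shifted-reindex : ∀ c e → c ≤ s → e ≤ s → Σ≤ s (λ k → Σ≤ s (shifted c e k)) ≈ lifted c e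
      shifted-reindex c e c≤s e≤s = begin
        Σ≤ s (λ k → Σ≤ s (shifted c e k))
          ≈⟨ Σ≤-cong s (λ k _ → Σ≤-if (does (c ℕ.≤? k)) s _) ⟩
        Σ≤ s (λ k → if does (c ℕ.≤? k) then Σ≤ s (λ l → if does (e ℕ.≤? l) then
                      (if does (deg 0 0 k l ℕ.≟ s) then G (k ∸ c) (l ∸ e) else 0#) else 0#) else 0#)
          ≈⟨ Σ≤-reindex c s (λ k k′ → Σ≤ s λ l → if does (e ℕ.≤? l) then
                      (if does (deg 0 0 k l ℕ.≟ s) then G k′ (l ∸ e) else 0#) else 0#) c≤s ⟩
        (Σ≤ (s ∸ c) λ k′ → Σ≤ s λ l → if does (e ℕ.≤? l) then
                      (if does (deg 0 0 (k′ ℕ.+ c) l ℕ.≟ s) then G k′ (l ∸ e) else 0#) else 0#)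
          ≈⟨ Σ≤-cong (s ∸ c) (λ k′ _ →
               Σ≤-reindex e s (λ l l′ → if does (deg 0 0 (k′ ℕ.+ c) l ℕ.≟ s) then G k′ l′ else 0#) e≤s) ⟩
        lifted c e ∎

      shifted-vanishes : ∀ c e → c ≤ s → e ≤ s → 1 ≤ c ℕ.+ e → Σ≤ s (λ k → Σ≤ s (shifted c e k)) ≈ 0#
      shifted-vanishes c e c≤s e≤s 1≤c+e = trans (shifted-reindex c e c≤s e≤s) (lower-degree (deg 0 0 c e ℕ.≤? s))
        where
        D = deg 0 0 c e
        lower-degree : Dec (D ≤ s) → lifted c e ≈ 0#
        lower-degree (no D≰s) = Σ≤-zero (s ∸ c) _ λ k′ _ → Σ≤-zero (s ∸ e) _ λ l′ _ →
          if-no (deg 0 0 (k′ ℕ.+ c) (l′ ℕ.+ e) ℕ.≟ s) λ deg≡s →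
            D≰s (≤-trans (m≤n+m D (deg 0 0 k′ l′)) (≤-reflexive (≡.trans (≡.sym (deg-shift 0 0 k′ l′ c e)) deg≡s)))
        lower-degree (yes D≤s) = begin
          lifted c e
            ≈⟨ Σ≤-cong (s ∸ c) (λ k′ _ → Σ≤-cong (s ∸ e) (λ l′ _ →
                 if-agree (lower k′ l′) (raise k′ l′)
                          (deg 0 0 (k′ ℕ.+ c) (l′ ℕ.+ e) ℕ.≟ s) (deg 0 0 k′ l′ ℕ.≟ s ∸ D))) ⟩
          (Σ≤ (s ∸ c) λ k′ → Σ≤ (s ∸ e) λ l′ → if does (deg 0 0 k′ l′ ℕ.≟ s ∸ D) then G k′ l′ else 0#)
            ≈⟨ Φ-range (s ∸ D) (s ∸ c) (s ∸ e) G (ℕ.∸-monoʳ-≤ s c≤D) (ℕ.∸-monoʳ-≤ s e≤D) ⟩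
          Φ (s ∸ D) G
            ≈⟨ Φ-toric (s ∸ D) g g-toric (λ i j k l deg≡s∸D 1≤i+j →
                 no-mixed i j (k ℕ.+ c) (l ℕ.+ e) (raise-deg i j k l deg≡s∸D) 1≤i+j
                          (≤-trans 1≤c+e (ℕ.+-mono-≤ (m≤n+m c k) (m≤n+m e l)))) ⟩
          0# ∎
          where
          raise-deg : ∀ i j k l → deg i j k l ≡ s ∸ D → deg i j (k ℕ.+ c) (l ℕ.+ e) ≡ s
          raise-deg i j k l eq = ≡.trans (deg-shift i j k l c e) (≡.trans (≡.cong (ℕ._+ D) eq) (ℕ.m∸n+n≡m D≤s))
          raise : ∀ k′ l′ → deg 0 0 k′ l′ ≡ s ∸ D → deg 0 0 (k′ ℕ.+ c) (l′ ℕ.+ e) ≡ s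
          raise = raise-deg 0 0
          lower : ∀ k′ l′ → deg 0 0 (k′ ℕ.+ c) (l′ ℕ.+ e) ≡ s → deg 0 0 k′ l′ ≡ s ∸ D
          lower k′ l′ eq = ≡.trans (≡.sym (ℕ.m+n∸n≡m _ D)) (≡.cong (_∸ D) (≡.trans (≡.sym (deg-shift 0 0 k′ l′ c e)) eq))
          c≤D : c ≤ D
          c≤D = proj₁ (proj₂ (proj₂ (below-deg (0 , 0 , c , e))))
          e≤D : e ≤ D
          e≤D = proj₂ (proj₂ (proj₂ (below-deg (0 , 0 , c , e))))

      convolution-term : ∀ (h : Poly K) k l → k ≤ s → l ≤ s →
        (if does (deg 0 0 k l ℕ.≟ s) then mulCoeff K h g 0 0 k l else 0#)
          ≈ (Σ≤ s λ c → Σ≤ s λ e → coeff h 0 0 c e * shifted c e k l)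
      convolution-term h k l k≤s l≤s = by-cases (deg 0 0 k l ℕ.≟ s)
        where
        by-cases : Dec (deg 0 0 k l ≡ s) →
          (if does (deg 0 0 k l ℕ.≟ s) then mulCoeff K h g 0 0 k l else 0#)
            ≈ (Σ≤ s λ c → Σ≤ s λ e → coeff h 0 0 c e * shifted c e k l)
        by-cases (no deg≢s) = trans (if-no (deg 0 0 k l ℕ.≟ s) deg≢s) (sym
          (Σ≤-zero s _ λ c _ → Σ≤-zero s _ λ e _ → trans (*-congˡ (if-zero (does (c ℕ.≤? k))
             (if-zero (does (e ℕ.≤? l)) (if-no (deg 0 0 k l ℕ.≟ s) deg≢s)))) (zeroʳ _)))
        by-cases (yes deg≡s) = trans (if-yes (deg 0 0 k l ℕ.≟ s) deg≡s) (sym (trans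
          (Σ²-truncate s s k l _ k≤s l≤s λ c e → λ
             { (inj₁ k<c) → trans (*-congˡ (if-no (c ℕ.≤? k) (<⇒≱ k<c))) (zeroʳ _)
             ; (inj₂ l<e) → trans (*-congˡ (if-zero (does (c ℕ.≤? k)) (if-no (e ℕ.≤? l) (<⇒≱ l<e)))) (zeroʳ _) })
          (Σ≤-cong k λ c c≤k → Σ≤-cong l λ e e≤l → *-congˡ
             (trans (if-yes (c ℕ.≤? k) c≤k) (trans (if-yes (e ℕ.≤? l) e≤l) (if-yes (deg 0 0 k l ℕ.≟ s) deg≡s))))))

      Φ-mul : ∀ (h : Poly K) → Φ s (mulCoeff K h g 0 0) ≈ coeff h 0 0 0 0 * Φ s G
      Φ-mul h = begin
        Φ s (mulCoeff K h g 0 0)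
          ≈⟨ Σ≤-cong s (λ k k≤s → Σ≤-cong s (λ l l≤s → convolution-term h k l k≤s l≤s)) ⟩
        (Σ≤ s λ k → Σ≤ s λ l → Σ≤ s λ c → Σ≤ s λ e → H c e * shifted c e k l)
          ≈⟨ Σ²-swap s (λ k l c e → H c e * shifted c e k l) ⟩
        (Σ≤ s λ c → Σ≤ s λ e → Σ≤ s λ k → Σ≤ s λ l → H c e * shifted c e k l)
          ≈⟨ Σ≤-cong s (λ c _ → Σ≤-cong s (λ e _ →
               sym (trans (Σ≤-*ˡ s (H c e) _) (Σ≤-cong s (λ k _ → Σ≤-*ˡ s (H c e) _))))) ⟩
        (Σ≤ s λ c → Σ≤ s λ e → H c e * Σ≤ s (λ k → Σ≤ s (shifted c e k)))
          ≈⟨ Σ²-point s 0 0 _ z≤n z≤n (λ c e c≤s e≤s c≢0⊎e≢0 →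
               trans (*-congˡ (shifted-vanishes c e c≤s e≤s (1≤+ c e c≢0⊎e≢0))) (zeroʳ _)) ⟩
        H 0 0 * Φ s G ∎
        where
        H = coeff h 0 0

-- Write M = n^(d/2) = 1 + p and q = 2M - 1 = 1 + 2p.  Then the generators of S_n are
-- a₁ = 2M(2M-1), a₂ = (2M-1)(2M+1), a₃ = 2M(2M+1), a₄ = (2M-1)(2M+1) + 4M.
module Weights (p : ℕ) where
  open import Data.Nat
  open import Data.Nat.Properties
  open import Data.Nat.Divisibility using (_∣_; ∣-refl; ∣m⇒∣m*n; ∣n⇒∣m*n; ∣m+n∣m⇒∣n; ∣⇒≤)
  open import Relation.Binary.PropositionalEquality

  q : ℕ
  q = 1 + 2 * p

  w₁ w₂ w₃ w₄ : ℕ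
  w₁ = (2 + 2 * p) * q
  w₂ = q * (3 + 2 * p)
  w₃ = (2 + 2 * p) * (3 + 2 * p)
  w₄ = q * (3 + 2 * p) + (4 + 4 * p)

  open Grading w₁ w₂ w₃ w₄ (s≤s z≤n) (s≤s z≤n) (s≤s z≤n) (s≤s z≤n) public

  -- the 2M degrees q·(a₃ + i), 0 ≤ i ≤ q, in which the minimal generators live
  σ : ℕ → ℕ
  σ i = q * (w₃ + i)

  σ-injective : ∀ i i′ → σ i ≡ σ i′ → i ≡ i′
  σ-injective i i′ e = +-cancelˡ-≡ w₃ i i′ (*-cancelˡ-≡ (w₃ + i) (w₃ + i′) q e)

  -- Modulo q the degree only sees c + d:  deg = q·Z + 2(c + d).
  deg-mod-q : ∀ a b c d → deg a b c d ≡
    q * (a * (2 + 2 * p) + b * (3 + 2 * p) + c * (4 + 2 * p) + d * (5 + 2 * p)) + 2 * (c + d)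
  deg-mod-q a b c d = identity p a b c d
    where
    identity : ∀ p a b c d →
      a * ((2 + 2 * p) * (1 + 2 * p)) + b * ((1 + 2 * p) * (3 + 2 * p))
        + c * ((2 + 2 * p) * (3 + 2 * p)) + d * ((1 + 2 * p) * (3 + 2 * p) + (4 + 4 * p))
      ≡ (1 + 2 * p) * (a * (2 + 2 * p) + b * (3 + 2 * p) + c * (4 + 2 * p) + d * (5 + 2 * p))
        + 2 * (c + d)
    identity = solve-∀

  -- Hence if deg a b c d = σ i then q ∣ c + d (q is odd).
  q∣c+d : ∀ i a b c d → deg a b c d ≡ σ i → q ∣ c + d
  q∣c+d i a b c d eq = ∣m+n∣m⇒∣n (subst (q ∣_) (halve p (c + d)) (∣n⇒∣m*n (1 + p) q∣2v)) (∣m⇒∣m*n (c + d) ∣-refl)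
    where
    Z = a * (2 + 2 * p) + b * (3 + 2 * p) + c * (4 + 2 * p) + d * (5 + 2 * p)
    q∣2v : q ∣ 2 * (c + d)
    q∣2v = ∣m+n∣m⇒∣n (subst (q ∣_) (trans (sym eq) (deg-mod-q a b c d)) (∣m⇒∣m*n (w₃ + i) ∣-refl))
                     (∣m⇒∣m*n Z ∣-refl)
    halve : ∀ p v → (1 + p) * (2 * v) ≡ (1 + 2 * p) * v + v
    halve = solve-∀

  -- Purity: in the degrees σ i no monomial involves both {x₁,x₂} and {x₃,x₄}.
  -- Such a monomial would need c + d ≥ q, and its degree would exceed w₁ + q·w₃ > σ i.
  purity : ∀ i a b c d → i ≤ q → deg a b c d ≡ σ i → 1 ≤ a + b → 1 ≤ c + d → ⊥
  purity i a b c d i≤q eq 1≤a+b 1≤c+d = <⇒≱ σ<deg (≤-reflexive eq)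
    where
    open ≤-Reasoning
    q≤c+d : q ≤ c + d
    q≤c+d = ∣⇒≤ {{>-nonZero 1≤c+d}} (q∣c+d i a b c d eq)
    σ-bound : ∀ p → (1 + 2 * p) * ((2 + 2 * p) * (3 + 2 * p) + (2 + 2 * p))
                  ≡ 1 * ((2 + 2 * p) * (1 + 2 * p)) + (1 + 2 * p) * ((2 + 2 * p) * (3 + 2 * p))
    σ-bound = solve-∀
    regroup : ∀ p a b c d →
      (a + b) * ((2 + 2 * p) * (1 + 2 * p)) + (c + d) * ((2 + 2 * p) * (3 + 2 * p))
        + (b * (1 + 2 * p) + d * (1 + 2 * p))
      ≡ a * ((2 + 2 * p) * (1 + 2 * p)) + b * ((1 + 2 * p) * (3 + 2 * p))
        + c * ((2 + 2 * p) * (3 + 2 * p)) + d * ((1 + 2 * p) * (3 + 2 * p) + (4 + 4 * p))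
    regroup = solve-∀
    σ<deg : σ i < deg a b c d
    σ<deg = begin-strict
      q * (w₃ + i)                  <⟨ *-monoʳ-< q (+-monoʳ-< w₃ (s≤s i≤q)) ⟩
      q * (w₃ + (2 + 2 * p))        ≡⟨ σ-bound p ⟩
      1 * w₁ + q * w₃               ≤⟨ +-mono-≤ (*-monoˡ-≤ w₁ 1≤a+b) (*-monoˡ-≤ w₃ q≤c+d) ⟩
      (a + b) * w₁ + (c + d) * w₃   ≤⟨ m≤m+n _ _ ⟩
      (a + b) * w₁ + (c + d) * w₃ + (b * q + d * q) ≡⟨ regroup p a b c d ⟩
      deg a b c d                   ∎

  deg-x₃x₄ : ∀ i j → i + j ≡ q → deg 0 0 j i ≡ σ i
  deg-x₃x₄ i j i+j≡q = trans (expand p i j) (trans (cong (λ z → z * w₃ + i * q) i+j≡q) (collect p i))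
    where
    expand : ∀ p i j → 0 * ((2 + 2 * p) * (1 + 2 * p)) + 0 * ((1 + 2 * p) * (3 + 2 * p))
      + j * ((2 + 2 * p) * (3 + 2 * p)) + i * ((1 + 2 * p) * (3 + 2 * p) + (4 + 4 * p))
      ≡ (i + j) * ((2 + 2 * p) * (3 + 2 * p)) + i * (1 + 2 * p)
    expand = solve-∀
    collect : ∀ p i → (1 + 2 * p) * ((2 + 2 * p) * (3 + 2 * p)) + i * (1 + 2 * p)
      ≡ (1 + 2 * p) * ((2 + 2 * p) * (3 + 2 * p) + i)
    collect = solve-∀

  deg-x₁x₂ : ∀ i j → i + j ≡ q → deg (2 + j) i 0 0 ≡ σ i
  deg-x₁x₂ i j i+j≡q = trans (expand p i j) (trans (cong (λ z → (2 + z) * w₁ + i * q) i+j≡q) (collect p i))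
    where
    expand : ∀ p i j → (2 + j) * ((2 + 2 * p) * (1 + 2 * p)) + i * ((1 + 2 * p) * (3 + 2 * p))
      + 0 * ((2 + 2 * p) * (3 + 2 * p)) + 0 * ((1 + 2 * p) * (3 + 2 * p) + (4 + 4 * p))
      ≡ (2 + (i + j)) * ((2 + 2 * p) * (1 + 2 * p)) + i * (1 + 2 * p)
    expand = solve-∀
    collect : ∀ p i → (2 + (1 + 2 * p)) * ((2 + 2 * p) * (1 + 2 * p)) + i * (1 + 2 * p)
      ≡ (1 + 2 * p) * ((2 + 2 * p) * (3 + 2 * p) + i)
    collect = solve-∀

  generators≡weights : ∀ k n → n ^ k ≡ suc p → a₁ k n ≡ w₁ × a₂ k n ≡ w₂ × a₃ k n ≡ w₃ × a₄ k n ≡ w₄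
  generators≡weights k n nᵏ≡M =
      trans (cong₂ (λ x y → 4 * x ∸ 2 * y) n²ᵏ≡M² nᵏ≡M) (minus w₁ (2 * suc p) (e₁ p))
    , trans (cong (λ x → 4 * x ∸ 1) n²ᵏ≡M²) (minus w₂ 1 (e₂ p))
    , trans (cong₂ (λ x y → 4 * x + 2 * y) n²ᵏ≡M² nᵏ≡M) (e₃ p)
    , trans (cong₂ (λ x y → 4 * x + 4 * y ∸ 1) n²ᵏ≡M² nᵏ≡M) (minus w₄ 1 (e₄ p))
    where
    n²ᵏ≡M² : n ^ (2 * k) ≡ suc p * suc p
    n²ᵏ≡M² = begin
      n ^ (2 * k)        ≡⟨ cong (n ^_) (double k) ⟩
      n ^ (k + k)        ≡⟨ ^-distribˡ-+-* n k k ⟩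
      n ^ k * n ^ k      ≡⟨ cong₂ _*_ nᵏ≡M nᵏ≡M ⟩
      suc p * suc p      ∎
      where
      open ≡-Reasoning
      double : ∀ k → 2 * k ≡ k + k
      double = solve-∀
    minus : ∀ w e {x} → x ≡ w + e → x ∸ e ≡ w
    minus w e refl = m+n∸n≡m w e
    e₁ : ∀ p → 4 * (suc p * suc p) ≡ (2 + 2 * p) * (1 + 2 * p) + 2 * suc p
    e₁ = solve-∀
    e₂ : ∀ p → 4 * (suc p * suc p) ≡ (1 + 2 * p) * (3 + 2 * p) + 1
    e₂ = solve-∀
    e₃ : ∀ p → 4 * (suc p * suc p) + 2 * suc p ≡ (2 + 2 * p) * (3 + 2 * p)
    e₃ = solve-∀
    e₄ : ∀ p → 4 * (suc p * suc p) + 4 * suc p ≡ (1 + 2 * p) * (3 + 2 * p) + (4 + 4 * p) + 1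
    e₄ = solve-∀

module LowerBound {c ℓ} (K : Field c ℓ) (p : ℕ) where
  open Weights p
  open Field K
  open FiniteSums K
  open LinearAlgebra K
  open Binomials K
  open PureParts K
  open import Relation.Binary.Reasoning.Setoid setoid
  open import Algebra.Properties.Ring ring using () renaming (-0#≈0# to -0≈0)

  N : ℕ
  N = 2 ℕ.* suc p

  -- the index t : Fin N stands for the exponent i = toℕ t ≤ q, with complement j = q − i
  iₜ jₜ : Fin N → ℕ
  iₜ t = toℕ t
  jₜ t = q ℕ.∸ iₜ t

  iₜ≤q : ∀ t → iₜ t ℕ.≤ q
  iₜ≤q t = ℕ.≤-pred (≡.subst (toℕ t <_) (N≡1+q p) (toℕ<n t))
    where
    N≡1+q : ∀ p → 2 ℕ.* suc p ≡ 1 ℕ.+ (1 ℕ.+ 2 ℕ.* p)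
    N≡1+q = solve-∀

  iₜ+jₜ≡q : ∀ t → iₜ t ℕ.+ jₜ t ≡ q
  iₜ+jₜ≡q t = ℕ.m+[n∸m]≡n (iₜ≤q t)

  αₜ βₜ : Fin N → Exponent
  αₜ t = 0 , 0 , jₜ t , iₜ t
  βₜ t = 2 ℕ.+ jₜ t , iₜ t , 0 , 0

  f : Fin N → Poly K
  f t = binomial (αₜ t) (βₜ t)

  deg-αₜ : ∀ t → degₑ (αₜ t) ≡ σ (iₜ t)
  deg-αₜ t = deg-x₃x₄ (iₜ t) (jₜ t) (iₜ+jₜ≡q t)

  f-toric : ∀ t → InToricIdeal K w₁ w₂ w₃ w₄ (f t)
  f-toric t = binomial-toric (αₜ t) (βₜ t) (≡.trans (deg-αₜ t) (≡.sym (deg-x₁x₂ (iₜ t) (jₜ t) (iₜ+jₜ≡q t))))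

  φ : Fin N → Poly K → Carrier
  φ d h = Φ (σ (iₜ d)) (coeff h 0 0)

  -- the only pure monomial of f_t is x^αₜ, of degree σ (iₜ t); so φ d (f t) = [t = d]
  φ-f : ∀ t d → φ d (f t) ≈ (if does (t Fin.≟ d) then 1# else 0#)
  φ-f t d = begin
    φ d (f t)
      ≈⟨ Σ²-point (σ (iₜ d)) (jₜ t) (iₜ t) _ (ℕ.≤-trans (ℕ.m∸n≤m q (iₜ t)) q≤σ) (ℕ.≤-trans (iₜ≤q t) q≤σ)
                  off-αₜ ⟩
    (if does (degₑ (αₜ t) ℕ.≟ σ (iₜ d)) then coeff (f t) 0 0 (jₜ t) (iₜ t) else 0#)
      ≈⟨ if-cong (does (degₑ (αₜ t) ℕ.≟ σ (iₜ d))) (x^β-absent (jₜ t) (iₜ t) (monomial-at 0 0 (jₜ t) (iₜ t))) ⟩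
    (if does (degₑ (αₜ t) ℕ.≟ σ (iₜ d)) then 1# else 0#)
      ≈⟨ if-agree same-degree (λ { ≡.refl → deg-αₜ t }) (degₑ (αₜ t) ℕ.≟ σ (iₜ d)) (t Fin.≟ d) ⟩
    (if does (t Fin.≟ d) then 1# else 0#) ∎
    where
    q≤σ : q ℕ.≤ σ (iₜ d)
    q≤σ = ℕ.m≤m*n q (w₃ ℕ.+ iₜ d)
    same-degree : degₑ (αₜ t) ≡ σ (iₜ d) → t ≡ d
    same-degree eq = toℕ-injective (σ-injective (iₜ t) (iₜ d) (≡.trans (≡.sym (deg-αₜ t)) eq))
    -- x^βₜ involves x₁, so it contributes nothing to a pure coefficient
    x^β-absent : ∀ k l {x} → monomial (αₜ t) 0 0 k l ≈ x → coeff (f t) 0 0 k l ≈ x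
    x^β-absent k l x^α≈x =
      trans (+-cong x^α≈x (-‿cong (monomial-off (βₜ t) 0 0 k l λ ()))) (trans (+-congˡ -0≈0) (+-identityʳ _))
    off-αₜ : ∀ k l → k ℕ.≤ σ (iₜ d) → l ℕ.≤ σ (iₜ d) → k ≢ jₜ t ⊎ l ≢ iₜ t →
      (if does (deg 0 0 k l ℕ.≟ σ (iₜ d)) then coeff (f t) 0 0 k l else 0#) ≈ 0#
    off-αₜ k l _ _ k≢j⊎l≢i = if-zero _ (x^β-absent k l (monomial-off (αₜ t) 0 0 k l
      (λ { ≡.refl → [ (λ k≢k → k≢k ≡.refl) , (λ l≢l → l≢l ≡.refl) ] k≢j⊎l≢i })))

  -- the vectors (φ d (f t))_d, t : Fin N, are the standard basis vectors, hence independent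
  f-independent : Independent N (λ t d → φ d (f t))
  f-independent α Σαf≈0 d = begin
    α d                          ≈⟨ sym (*-identityʳ _) ⟩
    α d * 1#                     ≈⟨ *-congˡ (sym (trans (φ-f d d) (if-yes (d Fin.≟ d) ≡.refl))) ⟩
    α d * φ d (f d)              ≈⟨ sym (Σ<-point N d (λ t → α t * φ d (f t)) off-diagonal) ⟩
    Σ< N (λ t → α t * φ d (f t)) ≈⟨ Σαf≈0 d ⟩
    0#                           ∎
    where
    off-diagonal : ∀ t → t ≢ d → α t * φ d (f t) ≈ 0#
    off-diagonal t t≢d = trans (*-congˡ (trans (φ-f t d) (if-no (t Fin.≟ d) t≢d))) (zeroʳ _)

  lower-bound : β₁≥ K w₁ w₂ w₃ w₄ N
  lower-bound m m<N g (g-toric , generates) =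
    dimension-bound m N m<N (λ t d → φ d (f t)) cf v f≈cf·v f-independent
    where
    h : Fin N → Fin m → Poly K
    h t = proj₁ (generates (f t) (f-toric t))
    cf : Fin N → Fin m → Carrier
    cf t r = coeff (h t r) 0 0 0 0
    v : Fin m → Fin N → Carrier
    v r d = φ d (g r)
    φ-mul : ∀ d r (h′ : Poly K) → Φ (σ (iₜ d)) (mulCoeff K h′ (g r) 0 0) ≈ coeff h′ 0 0 0 0 * φ d (g r)
    φ-mul d r = Multiplicative.Φ-mul (σ (iₜ d)) (λ a b c e → purity (iₜ d) a b c e (iₜ≤q d)) (g r) (g-toric r)
    f≈cf·v : IsCombination (λ t d → φ d (f t)) cf v
    f≈cf·v t d = begin
      φ d (f t)
        ≈⟨ Φ-cong (σ (iₜ d)) (proj₂ (generates (f t) (f-toric t)) 0 0) ⟩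
      Φ (σ (iₜ d)) (λ k l → Σ< m (λ r → mulCoeff K (h t r) (g r) 0 0 k l))
        ≈⟨ Φ-Σ< (σ (iₜ d)) m _ ⟩
      Σ< m (λ r → Φ (σ (iₜ d)) (mulCoeff K (h t r) (g r) 0 0))
        ≈⟨ Σ<-cong m (λ r → φ-mul d r (h t r)) ⟩
      Σ< m (λ r → cf t r * v r d) ∎

open import Data.Nat using (ℕ; _≤_; _*_; _^_)

theorem5p4 : ∀ {c ℓ : Level} (K : Field c ℓ) (k n : ℕ) → 1 ≤ k → 1 ≤ n →
    β₁≥ K (a₁ k n) (a₂ k n) (a₃ k n) (a₄ k n) (2 * n ^ k)
theorem5p4 K k n _ n≥1 = for-power (n ^ k) ≡.refl (ℕ.m^n>0 n {{ℕ.>-nonZero n≥1}} k)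
  where
  for-power : ∀ M → n ^ k ≡ M → 0 < M → β₁≥ K (a₁ k n) (a₂ k n) (a₃ k n) (a₄ k n) (2 * n ^ k)
  for-power (suc p) nᵏ≡M _ with Weights.generators≡weights p k n nᵏ≡M
  ... | a₁≡w₁ , a₂≡w₂ , a₃≡w₃ , a₄≡w₄ rewrite a₁≡w₁ | a₂≡w₂ | a₃≡w₃ | a₄≡w₄ | nᵏ≡M =
    LowerBound.lower-bound K p
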